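{- Let $r\ge1$, $n\ge1$, $\lambda\in\mathbb{Z}^{r+1}$ dominant ($\lambda_1\ge\dots\ge\lambda_{r+1}$), $\rho=(r,\dots,1,0)$, and let $\mu=(\mu_1,\dots,\mu_r)\in\mathbb{Z}^r$ interleave with $\lambda+\rho$, i.e. $\lambda_1+r\ge\mu_1\ge\lambda_2+r-1\ge\mu_2\ge\dots\ge\lambda_r+1\ge\mu_r\ge\lambda_{r+1}$. Let $\mathfrak{T}$ be any Gelfand–Tsetlin pattern of rank $r$ with top row $\lambda+\rho$ and second row $\mu$ (i.e. any vertex of the component $\mathcal{C}_\mu$ of $\mathcal{C}_{\lambda+\rho}$), let $\mathfrak{T}'$ be the rank $r-1$ pattern with top row $\mu$ obtained by deleting the top row of $\mathfrak{T}$, and let $\mathfrak{T}_*$ be the rank $r$ pattern with top row $\lambda+\rho$ whose row $i$ is $(\mu_i,\mu_{i+1},\dots,\mu_r)$ for every $1\le i\le r$ (the lowest vertex of $\mathcal{C}_\mu$). Write $\mathbf{y}=(x_1,\dots,x_r)$ and $d(\kappa)$ for the sum of the coordinates of $\kappa$. Then (a) $\mathbf{x}^{\mathrm{wt}(\mathfrak{T})}=\mathbf{y}^{\mathrm{wt}(\mathfrak{T}')}\cdot x_{r+1}^{d(\lambda+\rho)-d(\mu)}$; (b) $G^{(n,\lambda+\rho)}(\mathfrak{T})=G^{(n,\mu)}(\mathfrak{T}')\cdot G^{(n,\lambda+\rho)}(\mathfrak{T}_*)$.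
   Context: $\mathbf{x}=(x_1,\dots,x_{r+1})$, $\mathbf{x}^\nu=\prod x_i^{\nu_i}$. Parameters: $v=q^{ -1}$ and Gauss sums $g_j=\sum_{b\in(\mathfrak{o}_S/p)^\times}(b/p)_n^{\,j}\psi(b/p)$, where $\mathfrak{o}_S$ is a ring of $S$-integers (a PID) of a number field containing the $2n$-th roots of unity, $p$ a prime with residue field of size $q\equiv 1\bmod 2n$, $\psi$ an additive character of conductor $\mathfrak{o}_S$, $(\cdot/p)_n$ the $n$-th power residue symbol. $h^\flat(a)=1-v$ if $n\mid a$, $0$ otherwise; $g^\flat(a)=v\,g_a$. A Gelfand–Tsetlin pattern of rank $s$ with top row a non-increasing $\kappa\in\mathbb{Z}^{s+1}$ is an integer array $(a_{ij})_{0\le i\le j\le s}$ with top row $\kappa$ and $a_{i-1,j-1}\ge a_{ij}\ge a_{i-1,j}$; $\Gamma_{ij}=\sum_{k=j}^s(a_{ik}-a_{i-1,k})$; with $d_i=\sum_{j\ge i}a_{ij}$, $\mathrm{wt}(\mathfrak{T})=(d_s,d_{s-1}-d_s,\dots,d_0-d_1)\in\mathbb{Z}^{s+1}$; $G^{(n,\kappa)}(\mathfrak{T})=\prod_{1\le i\le j\le s}g_{ij}$, $g_{ij}=1$ if $a_{ij}=a_{i-1,j}<a_{i-1,j-1}$, $h^\flat(\Gamma_{ij})$ if $a_{i-1,j}<a_{ij}<a_{i-1,j-1}$, $g^\flat(\Gamma_{ij})$ if $a_{i-1,j}<a_{ij}=a_{i-1,j-1}$, $0$ if $a_{i-1,j}=a_{ij}=a_{i-1,j-1}$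 (empty product $=1$). Crystal interpretation: vertices of the type $A_r$ highest weight crystal $\mathcal{C}_{\lambda+\rho}$ correspond to rank $r$ patterns with top row $\lambda+\rho$; removing the edges labelled $r$ splits it into components $\mathcal{C}_\mu$ (for $\mu$ interleaving with $\lambda+\rho$), consisting of the vertices whose pattern has second row $\mu$, each a type $A_{r-1}$ highest weight crystal of highest weight $\mu$ whose vertices correspond to the patterns $\mathfrak{T}'$ and whose weight is $\mathrm{wt}(\mathfrak{T}')$. -}

module Defs where

open import Level using (Level)
open import Data.Nat as ℕ using (ℕ; zero; suc; _∸_)
open import Data.Nat.Divisibility using (_∣?_)
open import Data.Integer as ℤ using (ℤ; +_; _-_; _≤_; ∣_∣)
open import Data.Fin using (Fin; toℕ; inject₁)
  renaming (suc to fsuc)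
open import Data.Vec using (Vec; []; _∷_; lookup; tabulate; foldr)
open import Data.List as List using (List; applyUpTo; concatMap; map)
open import Data.Product using (_×_; _,_)
open import Data.Bool using (if_then_else_)
open import Relation.Nullary.Decidable using (⌊_⌋)
open import Relation.Binary.PropositionalEquality using (_≡_)
open import Algebra.Bundles using (CommutativeRing)

-- Gelfand–Tsetlin patterns are represented by a raw array a : ℕ → ℕ → ℤ,
-- entry a i j = a_{ij}; only the entries with 0 ≤ i ≤ j ≤ s are meaningful.
Array : Set
Array = ℕ → ℕ → ℤ

-- 0-based safe lookup of a vector (value 0 out of range; never used there)
at : ∀ {n} → Vec ℤ n → ℕ → ℤ
at []       _       = + 0
at (x ∷ xs) zero    = x
at (x ∷ xs) (suc j) = at xs j

dsum : ∀ {n} → Vec ℤ n → ℤ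
dsum = foldr _ ℤ._+_ (+ 0)

rho : (r : ℕ) → Vec ℤ (suc r)
rho r = tabulate (λ m → + (r ∸ toℕ m))

plusRho : ∀ {r} → Vec ℤ (suc r) → Vec ℤ (suc r)
plusRho {r} lam = tabulate (λ m → lookup lam m ℤ.+ + (r ∸ toℕ m))

Dominant : ∀ {r} → Vec ℤ (suc r) → Set
Dominant {r} lam = ∀ (m : Fin r) → lookup lam (fsuc m) ≤ lookup lam (inject₁ m)

Interleaves : ∀ {s} → Vec ℤ (suc s) → Vec ℤ s → Set
Interleaves {s} κ μ =
  ∀ (m : Fin s) → (lookup μ m ≤ lookup κ (inject₁ m)) × (lookup κ (fsuc m) ≤ lookup μ m)

IsGTP : (s : ℕ) → Vec ℤ (suc s) → Array → Set
IsGTP s κ a =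
  (∀ j → j ℕ.≤ s → a 0 j ≡ at κ j) ×
  (∀ i j → i ℕ.≤ j → suc j ℕ.≤ s →
     (a (suc i) (suc j) ≤ a i j) × (a i (suc j) ≤ a (suc i) (suc j)))

SecondRow : (s : ℕ) → Array → Vec ℤ s → Set
SecondRow s a μ = ∀ j → suc j ℕ.≤ s → a 1 (suc j) ≡ at μ j

dropTop : Array → Array
dropTop a i j = a (suc i) (suc j)

-- the lowest vertex T_* : top row κ, row i (i ≥ 1) is (μ_i, …, μ_s)
lowest : ∀ {s} → Vec ℤ (suc s) → Vec ℤ s → Array
lowest κ μ zero    j = at κ j
lowest κ μ (suc i) j = at μ (j ∸ 1)

range : ℕ → ℕ → List ℕ
range j s = applyUpTo (j ℕ.+_) (suc s ∸ j)

sumFrom : ℕ → ℕ → (ℕ → ℤ) → ℤ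
sumFrom j s f = List.foldr ℤ._+_ (+ 0) (map f (range j s))

dRow : (s : ℕ) → Array → ℕ → ℤ
dRow s a i = sumFrom i s (a i)

-- wt(T) = (d_s, d_{s-1} - d_s, …, d_0 - d_1)   (d_{s+1} = empty sum = 0)
wt : (s : ℕ) → Array → Vec ℤ (suc s)
wt s a = tabulate (λ m → dRow s a (s ∸ toℕ m) - dRow s a (suc (s ∸ toℕ m)))

Gamma : (s : ℕ) → Array → ℕ → ℕ → ℤ
Gamma s a i j = sumFrom j s (λ k → a i k - a (i ∸ 1) k)

-- The weight G^{(n,κ)}(T), with values in a commutative ring R, where
-- v plays the role of q^{-1} and gs j the role of the Gauss sum g_j.
module GTWeight {c ℓ : Level} (R : CommutativeRing c ℓ)
                (v : CommutativeRing.Carrier R)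
                (gs : ℤ → CommutativeRing.Carrier R)
                (n : ℕ) where
  open CommutativeRing R

  hflat : ℤ → Carrier
  hflat x = if ⌊ n ∣? ∣ x ∣ ⌋ then 1# + (- v) else 0#

  gflat : ℤ → Carrier
  gflat x = v * gs x

  gEntry : (s : ℕ) → Array → ℕ → ℕ → Carrier
  gEntry s a i j =
    let x  = a i j
        up = a (i ∸ 1) j
        ul = a (i ∸ 1) (j ∸ 1)
        Γ  = Gamma s a i j
    in if ⌊ x ℤ.≟ up ⌋
         then (if ⌊ x ℤ.≟ ul ⌋ then 0# else 1#)
         else (if ⌊ x ℤ.≟ ul ⌋ then gflat Γ else hflat Γ)

  pairs : ℕ → List (ℕ × ℕ)
  pairs s = concatMap (λ i → map (λ j → (i , j)) (range i s)) (range 1 s)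

  G : (s : ℕ) → Array → Carrier
  G s a = List.foldr _*_ 1# (map (λ p → gEntry s a (Data.Product.proj₁ p) (Data.Product.proj₂ p)) (pairs s))

{-# OPTIONS --safe #-}
-- (a) The row sums of T' are the row sums d₁, d₂, … of T, so the weights agree
-- in the first r coordinates, and the last one is d₀ − d₁ = d(λ+ρ) − d(μ).
-- (b) G is a product of row factors. Row 1 depends only on rows 0 and 1, which
-- T and T_* share, and rows 2, 3, … of T are the rows of T'. In rows ≥ 2 of T_*
-- every entry equals the entry above it, so each factor there is 0 or 1, and it
-- is 0 exactly at a repetition μ_{w+1} = μ_w; but then the entry of T below both
-- is pinched between them, so G(T') = 0 as well.
module Submission where

open import Level using (Level)
open import Data.Nat as ℕ using (ℕ; zero; suc; _∸_; _+_; _<_; _≤_; z≤n; s≤s)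
open import Data.Nat.Properties as ℕ using ()
open import Data.Integer as ℤ using (ℤ; _-_)
open import Data.Integer.Properties as ℤ using ()
open import Data.Fin using (Fin; toℕ; inject₁; fromℕ) renaming (zero to fzero; suc to fsuc)
open import Data.Fin.Properties using (toℕ-inject₁; toℕ-fromℕ; toℕ≤pred[n])
open import Data.Vec using (Vec; _∷ʳ_; tabulate) renaming (_∷_ to _∷ᵥ_; [] to []ᵥ)
open import Data.Vec.Properties using (tabulate-cong)
open import Data.List as List using (List; []; _∷_; _++_; applyUpTo; map; concatMap)
open import Data.List.Properties using (map-applyUpTo; map-++; map-∘; map-cong; map-cong-local)
open import Data.List.Relation.Unary.All using (All; []; _∷_)
import Data.List.Relation.Unary.All.Properties as All
open import Data.List.Relation.Unary.Any using (Any; here; there)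
import Data.List.Relation.Unary.Any.Properties as Any
open import Data.Product using (_×_; _,_; proj₁; proj₂)
open import Function using (_∘_)
open import Data.Bool using (if_then_else_)
open import Relation.Nullary using (yes; no; contradiction)
open import Relation.Nullary.Decidable using (⌊_⌋)
open import Relation.Binary.PropositionalEquality as ≡ using (_≡_; refl; cong; cong₂)
open import Algebra.Bundles using (Semiring; CommutativeRing)
import Algebra.Properties.CommutativeSemigroup as CommutativeSemigroupProperties

open import Defs

sumℤ : List ℤ → ℤ
sumℤ = List.foldr ℤ._+_ (ℤ.+ 0)

m<1+n∸o⇒o+m≤n : ∀ o n {m} → m < suc n ∸ o → o + m ≤ n
m<1+n∸o⇒o+m≤n zero          n       m<n   = ℕ.s≤s⁻¹ m<n
m<1+n∸o⇒o+m≤n (suc o)       (suc n) m<n∸o = s≤s (m<1+n∸o⇒o+m≤n o n m<n∸o)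
m<1+n∸o⇒o+m≤n (suc zero)    zero    ()
m<1+n∸o⇒o+m≤n (suc (suc o)) zero    ()

All-range : ∀ {p} {P : ℕ → Set p} j s → (∀ {k} → j ≤ k → k ≤ s → P k) → All P (range j s)
All-range j s P-range = All.applyUpTo⁺₁ (j +_) (suc s ∸ j)
  (λ {m} m< → P-range (ℕ.m≤m+n j m) (m<1+n∸o⇒o+m≤n j s m<))

map-range-cong : ∀ {a} {A : Set a} {f g : ℕ → A} j s →
                 (∀ {k} → j ≤ k → k ≤ s → f k ≡ g k) → map f (range j s) ≡ map g (range j s)
map-range-cong j s f≡g = map-cong-local (All-range j s f≡g)

map-range-suc : ∀ {a} {A : Set a} (f : ℕ → A) j s →
                map (λ k → f (suc k)) (range j s) ≡ map f (range (suc j) (suc s))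
map-range-suc f j s =
  ≡.trans (map-applyUpTo (j +_) _ (suc s ∸ j)) (≡.sym (map-applyUpTo (suc j +_) f (suc s ∸ j)))

sumFrom-cong : ∀ {f g : ℕ → ℤ} j s → (∀ {k} → j ≤ k → k ≤ s → f k ≡ g k) →
               sumFrom j s f ≡ sumFrom j s g
sumFrom-cong j s f≡g = cong sumℤ (map-range-cong j s f≡g)

sumFrom-suc : ∀ (f : ℕ → ℤ) j s → sumFrom j s (λ k → f (suc k)) ≡ sumFrom (suc j) (suc s) f
sumFrom-suc f j s = cong sumℤ (map-range-suc f j s)

sum-applyUpTo-at : ∀ {m} (κ : Vec ℤ m) → sumℤ (applyUpTo (at κ) m) ≡ dsum κ
sum-applyUpTo-at []ᵥ       = refl
sum-applyUpTo-at (x ∷ᵥ xs) = cong (ℤ._+_ x) (sum-applyUpTo-at xs)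

sumFrom-zero-dsum : ∀ {s} {f : ℕ → ℤ} (κ : Vec ℤ (suc s)) →
                  (∀ {j} → j ≤ s → f j ≡ at κ j) → sumFrom 0 s f ≡ dsum κ
sumFrom-zero-dsum {s} κ f≡κ = ≡.trans (sumFrom-cong 0 s (λ _ → f≡κ))
  (≡.trans (cong sumℤ (map-applyUpTo (λ k → k) (at κ) (suc s)))
           (sum-applyUpTo-at κ))

tabulate-∷ʳ : ∀ {a} {A : Set a} n (f : Fin (suc n) → A) →
              tabulate f ≡ tabulate (λ m → f (inject₁ m)) ∷ʳ f (fromℕ n)
tabulate-∷ʳ zero    f = refl
tabulate-∷ʳ (suc n) f = cong (f fzero ∷ᵥ_) (tabulate-∷ʳ n (λ m → f (fsuc m)))

TopRow : (s : ℕ) → Array → Vec ℤ (suc s) → Set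
TopRow s a κ = ∀ j → j ≤ s → a 0 j ≡ at κ j

dRow-dropTop : ∀ r a i → dRow r (dropTop a) i ≡ dRow (suc r) a (suc i)
dRow-dropTop r a i = sumFrom-suc (a (suc i)) i r

wt-dropTop : ∀ {r} a κ μ → TopRow (suc r) a κ → SecondRow (suc r) a μ →
             wt (suc r) a ≡ wt r (dropTop a) ∷ʳ (dsum κ - dsum μ)
wt-dropTop {r} a κ μ top second =
  ≡.trans (tabulate-∷ʳ (suc r) entry) (cong₂ _∷ʳ_ (tabulate-cong inner) last)
  where
  d : ℕ → ℤ
  d = dRow (suc r) a

  entry : Fin (suc (suc r)) → ℤ
  entry m = d (suc r ∸ toℕ m) - d (suc (suc r ∸ toℕ m))

  inner : ∀ (m : Fin (suc r)) →
          entry (inject₁ m) ≡ dRow r (dropTop a) (r ∸ toℕ m) - dRow r (dropTop a) (suc (r ∸ toℕ m))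
  inner m = ≡.trans
    (cong (λ i → d i - d (suc i))
          (≡.trans (cong (suc r ∸_) (toℕ-inject₁ m)) (ℕ.+-∸-assoc 1 (toℕ≤pred[n] m))))
    (≡.sym (cong₂ _-_ (dRow-dropTop r a (r ∸ toℕ m)) (dRow-dropTop r a (suc (r ∸ toℕ m)))))

  last : entry (fromℕ (suc r)) ≡ dsum κ - dsum μ
  last = ≡.trans
    (cong (λ i → d i - d (suc i))
          (≡.trans (cong (suc r ∸_) (toℕ-fromℕ (suc r))) (ℕ.n∸n≡0 (suc r))))
    (cong₂ _-_ (sumFrom-zero-dsum κ (top _))
               (≡.trans (≡.sym (sumFrom-suc (a 1) 0 r)) (sumFrom-zero-dsum μ (second _ ∘ s≤s))))

module Product {c ℓ} (R : Semiring c ℓ) where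
  open Semiring R renaming (refl to ≈-refl)
  open import Relation.Binary.Reasoning.Setoid setoid

  prod : List Carrier → Carrier
  prod = List.foldr _*_ 1#

  prod-++ : ∀ xs ys → prod (xs ++ ys) ≈ prod xs * prod ys
  prod-++ []       ys = sym (*-identityˡ _)
  prod-++ (x ∷ xs) ys = trans (*-congˡ (prod-++ xs ys)) (sym (*-assoc _ _ _))

  prod-concatMap : ∀ {a} {A B : Set a} (f : B → Carrier) (g : A → List B) xs →
                   prod (map f (concatMap g xs)) ≈ prod (map (λ x → prod (map f (g x))) xs)
  prod-concatMap f g []       = ≈-refl
  prod-concatMap f g (x ∷ xs) = begin
    prod (map f (g x ++ concatMap g xs))            ≡⟨ cong prod (map-++ f (g x) (concatMap g xs)) ⟩
    prod (map f (g x) ++ map f (concatMap g xs))    ≈⟨ prod-++ (map f (g x)) _ ⟩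
    prod (map f (g x)) * prod (map f (concatMap g xs)) ≈⟨ *-congˡ (prod-concatMap f g xs) ⟩
    prod (map f (g x)) * prod (map (λ y → prod (map f (g y))) xs) ∎

  prod-zero : ∀ {xs} → Any (_≈ 0#) xs → prod xs ≈ 0#
  prod-zero (here x≈0)  = trans (*-congʳ x≈0) (zeroˡ _)
  prod-zero (there any) = trans (*-congˡ (prod-zero any)) (zeroʳ _)

  prod-absorbed : ∀ {X xs} → All (λ x → X * x ≈ X) xs → X * prod xs ≈ X
  prod-absorbed []                        = *-identityʳ _
  prod-absorbed {X} {x ∷ xs} (Xx≈X ∷ all) = begin
    X * (x * prod xs) ≈⟨ *-assoc X x (prod xs) ⟨
    (X * x) * prod xs ≈⟨ *-congʳ Xx≈X ⟩
    X * prod xs       ≈⟨ prod-absorbed all ⟩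
    X                 ∎

module Factorisation {c ℓ : Level} (R : CommutativeRing c ℓ)
                     (v : CommutativeRing.Carrier R) (gs : ℤ → CommutativeRing.Carrier R)
                     (n : ℕ) where
  open CommutativeRing R hiding (_+_; _-_) renaming (refl to ≈-refl)
  open GTWeight R v gs n
  open Product semiring
  open CommutativeSemigroupProperties *-commutativeSemigroup using (x∙yz≈y∙xz)
  open import Relation.Binary.Reasoning.Setoid setoid

  gValue : ℤ → ℤ → ℤ → ℤ → Carrier
  gValue x up ul Γ = if ⌊ x ℤ.≟ up ⌋
                       then (if ⌊ x ℤ.≟ ul ⌋ then 0# else 1#)
                       else (if ⌊ x ℤ.≟ ul ⌋ then gflat Γ else hflat Γ)

  gValue-cong : ∀ {x up ul Γ x′ up′ ul′ Γ′} → x ≡ x′ → up ≡ up′ → ul ≡ ul′ → Γ ≡ Γ′ →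
                gValue x up ul Γ ≡ gValue x′ up′ ul′ Γ′
  gValue-cong refl refl refl refl = refl

  gValue-pinched : ∀ x Γ → gValue x x x Γ ≡ 0#
  gValue-pinched x Γ with x ℤ.≟ x
  ... | yes _   = refl
  ... | no x≢x = contradiction refl x≢x

  gEntry-pinched : ∀ s a i j → a i j ≡ a (i ∸ 1) j → a i j ≡ a (i ∸ 1) (j ∸ 1) → gEntry s a i j ≡ 0#
  gEntry-pinched s a i j ≡up ≡ul =
    ≡.trans (gValue-cong (refl {x = a i j}) (≡.sym ≡up) (≡.sym ≡ul) (refl {x = Gamma s a i j}))
            (gValue-pinched (a i j) (Gamma s a i j))

  gValue-absorbed : ∀ {X} x y Γ → (x ≡ y → X ≈ 0#) → X * gValue x x y Γ ≈ X
  gValue-absorbed x y Γ X≈0 with x ℤ.≟ x | x ℤ.≟ y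
  ... | no x≢x | _       = contradiction refl x≢x
  ... | yes _  | yes x≡y = trans (zeroʳ _) (sym (X≈0 x≡y))
  ... | yes _  | no _    = *-identityʳ _

  rowWeight : ℕ → Array → ℕ → Carrier
  rowWeight s a i = prod (map (gEntry s a i) (range i s))

  lowerWeight : ℕ → Array → Carrier
  lowerWeight r a = prod (map (rowWeight (suc r) a) (range 2 (suc r)))

  G-rows : ∀ s a → G s a ≈ prod (map (rowWeight s a) (range 1 s))
  G-rows s a = trans (prod-concatMap _ (λ i → map (i ,_) (range i s)) (range 1 s))
    (reflexive (cong prod (map-cong (λ i → cong prod (≡.sym (map-∘ (range i s)))) (range 1 s))))

  G-suc : ∀ r a → G (suc r) a ≈ rowWeight (suc r) a 1 * lowerWeight r a
  G-suc r a = G-rows (suc r) a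

  gEntry-dropTop : ∀ r a i j →
                   gEntry r (dropTop a) (suc i) (suc j) ≡ gEntry (suc r) a (suc (suc i)) (suc (suc j))
  gEntry-dropTop r a i j =
    cong (gValue (a (suc (suc i)) (suc (suc j))) (a (suc i) (suc (suc j))) (a (suc i) (suc j)))
         (sumFrom-suc (λ k → a (suc (suc i)) k - a (suc i) k) (suc j) r)

  rowWeight-dropTop : ∀ r a i → rowWeight r (dropTop a) (suc i) ≡ rowWeight (suc r) a (suc (suc i))
  rowWeight-dropTop r a i =
    cong prod (≡.trans (map-range-cong (suc i) r shifted)
                       (map-range-suc (gEntry (suc r) a (suc (suc i))) (suc i) r))
    where
    shifted : ∀ {k} → suc i ≤ k → k ≤ r →
              gEntry r (dropTop a) (suc i) k ≡ gEntry (suc r) a (suc (suc i)) (suc k)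
    shifted {suc k} _ _ = gEntry-dropTop r a i k

  G-dropTop : ∀ r a → G r (dropTop a) ≈ lowerWeight r a
  G-dropTop r a = trans (G-rows r (dropTop a))
    (reflexive (cong prod (≡.trans (map-range-cong 1 r shifted)
                                   (map-range-suc (rowWeight (suc r) a) 1 r))))
    where
    shifted : ∀ {i} → 1 ≤ i → i ≤ r → rowWeight r (dropTop a) i ≡ rowWeight (suc r) a (suc i)
    shifted {suc i} _ _ = rowWeight-dropTop r a i

  rowWeight₁-cong : ∀ s a b → (∀ {j} → j ≤ s → a 0 j ≡ b 0 j) →
                    (∀ {j} → 1 ≤ j → j ≤ s → a 1 j ≡ b 1 j) → rowWeight s a 1 ≡ rowWeight s b 1
  rowWeight₁-cong s a b row₀ row₁ = cong prod (map-range-cong 1 s entry)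
    where
    entry : ∀ {j} → 1 ≤ j → j ≤ s → gEntry s a 1 j ≡ gEntry s b 1 j
    entry {suc j} 1≤j j<s = gValue-cong (row₁ 1≤j j<s) (row₀ j<s) (row₀ (ℕ.<⇒≤ j<s))
      (sumFrom-cong (suc j) s (λ j≤k k≤s → cong₂ _-_ (row₁ (ℕ.≤-trans 1≤j j≤k) k≤s) (row₀ k≤s)))

  lowerWeight-repeat : ∀ {r} κ μ T {w} → IsGTP (suc r) κ T → SecondRow (suc r) T μ →
                       w < r → at μ (suc w) ≡ at μ w → lowerWeight r T ≈ 0#
  lowerWeight-repeat {r} κ μ T {w} (_ , interlaced) second w<r repeat =
    prod-zero (Any.map⁺ (Any.applyUpTo⁺ (2 +_) row₂≈0 (ℕ.≤-trans (s≤s z≤n) w<r)))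
    where
    above≡aboveLeft : T 1 (2 + w) ≡ T 1 (1 + w)
    above≡aboveLeft = ≡.trans (second (suc w) (s≤s w<r)) (≡.trans repeat (≡.sym (second w (ℕ.<⇒≤ (s≤s w<r)))))

    bounds : (T 2 (2 + w) ℤ.≤ T 1 (1 + w)) × (T 1 (2 + w) ℤ.≤ T 2 (2 + w))
    bounds = interlaced 1 (suc w) (s≤s z≤n) (s≤s w<r)

    squeezed : T 2 (2 + w) ≡ T 1 (1 + w)
    squeezed = ℤ.≤-antisym (proj₁ bounds) (≡.subst (ℤ._≤ T 2 (2 + w)) above≡aboveLeft (proj₂ bounds))

    row₂≈0 : rowWeight (suc r) T 2 ≈ 0#
    row₂≈0 = prod-zero (Any.map⁺ (Any.applyUpTo⁺ (2 +_)
      (reflexive (gEntry-pinched (suc r) T 2 (2 + w) (≡.trans squeezed (≡.sym above≡aboveLeft)) squeezed))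
      w<r))

  lowerWeight-absorbs-lowest : ∀ {r} κ μ T → IsGTP (suc r) κ T → SecondRow (suc r) T μ →
                               lowerWeight r T * lowerWeight r (lowest κ μ) ≈ lowerWeight r T
  lowerWeight-absorbs-lowest {r} κ μ T gtp second =
    prod-absorbed (All.map⁺ (All.applyUpTo⁺₂ (2 +_) r row))
    where
    row : ∀ i → lowerWeight r T * rowWeight (suc r) (lowest κ μ) (2 + i) ≈ lowerWeight r T
    row i = prod-absorbed (All.map⁺ (All-range (2 + i) (suc r) entry))
      where
      entry : ∀ {k} → 2 + i ≤ k → k ≤ suc r →
              lowerWeight r T * gEntry (suc r) (lowest κ μ) (2 + i) k ≈ lowerWeight r T
      entry (s≤s (s≤s _)) (s≤s w<r) =
        gValue-absorbed _ _ _ (lowerWeight-repeat κ μ T gtp second w<r)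

  G-factorises : ∀ {r} κ μ T → IsGTP (suc r) κ T → SecondRow (suc r) T μ →
                 G (suc r) T ≈ G r (dropTop T) * G (suc r) (lowest κ μ)
  G-factorises {r} κ μ T gtp second = begin
    G (suc r) T                  ≈⟨ G-suc r T ⟩
    A * X                        ≈⟨ *-congˡ (lowerWeight-absorbs-lowest κ μ T gtp second) ⟨
    A * (X * Y)                  ≈⟨ x∙yz≈y∙xz A X Y ⟩
    X * (A * Y)                  ≈⟨ *-cong (G-dropTop r T) (*-congʳ (reflexive sameFirstRow)) ⟨
    G r (dropTop T) * (A* * Y)   ≈⟨ *-congˡ (G-suc r (lowest κ μ)) ⟨
    G r (dropTop T) * G (suc r) (lowest κ μ) ∎
    where
    A  = rowWeight (suc r) T 1
    A* = rowWeight (suc r) (lowest κ μ) 1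
    X  = lowerWeight r T
    Y  = lowerWeight r (lowest κ μ)

    row₁ : ∀ {j} → 1 ≤ j → j ≤ suc r → lowest κ μ 1 j ≡ T 1 j
    row₁ {suc j} _ j<r = ≡.sym (second j j<r)

    sameFirstRow : A* ≡ A
    sameFirstRow = rowWeight₁-cong (suc r) (lowest κ μ) T (λ {j} j≤r → ≡.sym (proj₁ gtp j j≤r)) row₁

proposition4p13 : ∀ {c ℓ} (R : CommutativeRing c ℓ)
    (v : CommutativeRing.Carrier R) (gs : ℤ → CommutativeRing.Carrier R)
    (r' n : ℕ) → 1 ≤ n →
    (lam : Vec ℤ (suc (suc r'))) → Dominant lam →
    (μ : Vec ℤ (suc r')) → Interleaves (plusRho lam) μ →
    (T : Array) → IsGTP (suc r') (plusRho lam) T → SecondRow (suc r') T μ →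
    (wt (suc r') T ≡ (wt r' (dropTop T) ∷ʳ (dsum (plusRho lam) - dsum μ)))
    × CommutativeRing._≈_ R
    (GTWeight.G R v gs n (suc r') T)
    (CommutativeRing._*_ R
    (GTWeight.G R v gs n r' (dropTop T))
    (GTWeight.G R v gs n (suc r') (lowest (plusRho lam) μ)))
proposition4p13 R v gs r' n _ lam _ μ _ T gtp second =
  wt-dropTop T (plusRho lam) μ (proj₁ gtp) second ,
  Factorisation.G-factorises R v gs n (plusRho lam) μ T gtp second
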